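{- For every positive integer $t$, \[\pi_t^*(K_2\Box K_3)=\max\left(\left\lceil \frac{2}{3}\pi^*_{2t}(K_3)\right\rceil,\ \left\lceil\frac{3}{4}\pi^*_{2t}(K_2)\right\rceil\right).\] In particular, writing $t=6q+r$ with $q=\lfloor t/6\rfloor$ and $0\le r\le 5$, \[\pi_t^*(K_2\Box K_3)=\begin{cases}12q & \text{if } r=0,\\ 12q+2r+1 & \text{otherwise}.\end{cases}\]
   Context: A distribution on a graph $G=(V,E)$ is a function $D:V\to\mathbb{N}$, with size $|D|=\sum_v D(v)$. A pebbling move removes two pebbles from a vertex having at least two pebbles and places one pebble on a neighbor. A distribution $D$ is $t$-solvable if for every vertex $v$, some sequence of pebbling moves starting from $D$ results in a distribution with at least $t$ pebbles on $v$. The optimal $t$-pebbling number $\pi_t^*(G)$ is the minimum size of a $t$-solvable distribution on $G$. $K_n$ is the complete graph on $n$ vertices and $\Box$ is the Cartesian product of graphs. -}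

module Defs where

open import Data.Nat using (ℕ; zero; suc; _+_; _*_; _∸_; _≤_; _⊔_; _/_; _%_)
open import Data.Fin using (Fin; remQuot)
open import Data.Fin.Properties using (_≟_)
open import Data.Product using (Σ; ∃; _×_; _,_; proj₁; proj₂)
open import Data.Sum using (_⊎_)
open import Relation.Binary.PropositionalEquality using (_≡_; _≢_)
open import Relation.Nullary using (yes; no)
open import Relation.Binary.Construct.Closure.ReflexiveTransitive using (Star)
import Data.Vec.Functional as VF

record Graph : Set₁ where
  field
    n   : ℕ
    Adj : Fin n → Fin n → Set
open Graph public

K : ℕ → Graph
K m = record { n = m ; Adj = λ i j → i ≢ j }

_□_ : Graph → Graph → Graph
G □ H = record
  { n   = n G * n H
  ; Adj = λ x y →
      let (a , b)   = remQuot (n H) x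
          (a′ , b′) = remQuot (n H) y
      in (Adj G a a′ × b ≡ b′) ⊎ (a ≡ a′ × Adj H b b′)
  }

Distribution : Graph → Set
Distribution G = Fin (n G) → ℕ

size : (G : Graph) → Distribution G → ℕ
size G D = VF.foldr _+_ 0 D

move : (G : Graph) → Fin (n G) → Fin (n G) → Distribution G → Distribution G
move G u v D w with w ≟ u
... | yes _ = D w ∸ 2
... | no _ with w ≟ v
...   | yes _ = suc (D w)
...   | no _  = D w

data Step (G : Graph) : Distribution G → Distribution G → Set where
  step : ∀ {D} u v → Adj G u v → 2 ≤ D u → Step G D (move G u v D)

Reach : (G : Graph) → Distribution G → Distribution G → Set
Reach G = Star (Step G)

Solvable : (G : Graph) → ℕ → Distribution G → Set
Solvable G t D = ∀ v → ∃ λ D′ → Reach G D D′ × t ≤ D′ v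

IsOptPebbling : (G : Graph) → ℕ → ℕ → Set
IsOptPebbling G t k =
  (∃ λ D → Solvable G t D × size G D ≡ k) × (∀ D → Solvable G t D → k ≤ size G D)

⌈_/3⌉ : ℕ → ℕ
⌈ a /3⌉ = (a + 2) / 3

⌈_/4⌉ : ℕ → ℕ
⌈ a /4⌉ = (a + 3) / 4

closedForm : ℕ → ℕ
closedForm t with t % 6
... | zero  = 12 * (t / 6)
... | suc r = 12 * (t / 6) + 2 * suc r + 1

-- Upper bounds are explicit: a periodic unit (two pebbles on every vertex of K₃ and
-- of K₂ □ K₃, four on every vertex of K₂) plus a base distribution for each residue,
-- each certified by move scripts that are checked by evaluation.
-- Lower bounds use weight functions. Seen from a target v, x pebbles at distance
-- 0, 1, ≥ 2 are worth 4x, 2x, 2⌊x/2⌋; no pebbling move increases this value, so a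
-- distribution that can put s pebbles on every vertex is worth at least 4s from every
-- target. Summing over all targets bounds the size. If the bound is attained, every
-- vertex carries an even number of pebbles and every value is exactly 4s, and these
-- linear equations force 2 ∣ t on K₃ and 6 ∣ t on K₂ □ K₃.
-- Both sides of the max formula grow by 12 when t grows by 6.
module Submission where

open import Defs
open import Data.Bool.Base using (Bool; false; T)
open import Data.Fin.Base using (Fin; zero; suc; punchIn; quotient; remainder; combine; _↑ˡ_; _↑ʳ_)
open import Data.Fin.Patterns using (0F; 1F; 2F; 3F; 4F; 5F)
open import Data.Fin.Properties using (_≟_; punchInᵢ≢i; all?; remQuot-combine)
open import Data.List.Base using (List; []; _∷_)
open import Data.Maybe.Base using (Maybe; just; nothing; maybe)
open import Data.Nat.Base using (ℕ; zero; suc; _+_; _*_; _∸_; _≤_; _<_; _⊔_; _/_; _%_; _≤ᵇ_; ⌊_/2⌋; ⌈_/2⌉; s≤s; z≤n; NonZero)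
open import Data.Nat.DivMod using (m≡m%n+[m/n]*n; m%n<n; +-distrib-/-∣ˡ; m*n/n≡m; /-monoˡ-≤)
open import Data.Nat.Divisibility using (_∣_; divides; divides-refl; n∣m⇒m%n≡0)
open import Data.Nat.Properties hiding (_≟_)
open import Algebra.Properties.CommutativeSemigroup +-commutativeSemigroup
  using (xy∙z≈xz∙y; xy∙z≈zy∙x; x∙yz≈yx∙z; x∙yz≈y∙xz)
open import Algebra.Properties.Semiring.Sum +-*-semiring
  using (sum; sum-syntax; sum-cong-≗; sum-remove; ∑-comm; ∑-distrib-+; *-distribˡ-sum)
open import Data.Nat.Tactic.RingSolver using (solve-∀)
open import Data.Product using (Σ; ∃; _,_; _×_; proj₁; proj₂; uncurry)
open import Data.Sum using (inj₁; inj₂)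
open import Data.Vec.Base using (lookup; _∷_; [])
open import Data.Vec.Functional using (updateAt)
open import Data.Vec.Functional.Properties using (updateAt-updates; updateAt-minimal)
open import Function.Base using (_∘_; case_of_)
open import Relation.Binary.Construct.Closure.ReflexiveTransitive using (ε; _◅_; _◅◅_)
open import Relation.Binary.Definitions using (Decidable)
open import Relation.Binary.PropositionalEquality
open import Relation.Nullary using (¬_; yes; no; contradiction; ¬?)
open import Relation.Nullary.Decidable using (True; toWitness; T?; _×-dec_; _⊎-dec_)

∑-mono-≤ : ∀ {n} {f g : Fin n → ℕ} → (∀ i → f i ≤ g i) → sum f ≤ sum g
∑-mono-≤ {zero}  f≤g = z≤n
∑-mono-≤ {suc n} f≤g = +-mono-≤ (f≤g zero) (∑-mono-≤ (f≤g ∘ suc))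

∑-tight : ∀ {n} {f g : Fin n → ℕ} → (∀ i → f i ≤ g i) → sum g ≤ sum f → ∀ i → f i ≡ g i
∑-tight {suc n} {f} {g} f≤g Σg≤Σf zero    = ≤-antisym (f≤g zero)
  (+-cancelʳ-≤ _ _ _ (≤-trans Σg≤Σf (+-monoʳ-≤ (f zero) (∑-mono-≤ (f≤g ∘ suc)))))
∑-tight {suc n} {f} {g} f≤g Σg≤Σf (suc i) = ∑-tight (f≤g ∘ suc)
  (+-cancelˡ-≤ _ _ _ (≤-trans Σg≤Σf (+-monoˡ-≤ _ (f≤g zero)))) i

∑-term-≤ : ∀ {n} (f : Fin n → ℕ) i → f i ≤ sum f
∑-term-≤ {suc n} f i = ≤-trans (m≤m+n (f i) _) (≤-reflexive (sym (sum-remove f)))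

∑-const : ∀ n c → ∑[ i < n ] c ≡ n * c
∑-const zero    c = refl
∑-const (suc n) c = cong (c +_) (∑-const n c)

∑-update : ∀ {n} {f g : Fin n → ℕ} i → (∀ k → k ≢ i → f k ≡ g k) → sum f + g i ≡ sum g + f i
∑-update {suc n} {f} {g} i f≡g = begin
  sum f + g i                                   ≡⟨ cong (_+ g i) (sum-remove f) ⟩
  f i + sum (f ∘ punchIn i) + g i               ≡⟨ cong (λ s → f i + s + g i) (sum-cong-≗ (λ k → f≡g _ (punchInᵢ≢i i k))) ⟩
  f i + sum (g ∘ punchIn i) + g i               ≡⟨ xy∙z≈zy∙x (f i) _ (g i) ⟩
  g i + sum (g ∘ punchIn i) + f i               ≡⟨ cong (_+ f i) (sum-remove g) ⟨
  sum g + f i                                   ∎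
  where open ≡-Reasoning

∑-two-point-≤ : ∀ {n} {f g : Fin n → ℕ} {i j} → i ≢ j → (∀ k → k ≢ i → k ≢ j → f k ≡ g k) →
                f i + f j ≤ g i + g j → sum f ≤ sum g
∑-two-point-≤ {suc n} {f} {g} {i} {j} i≢j f≡g fij≤gij = +-cancelʳ-≤ (g i + g j) (sum f) (sum g) (begin
  sum f + (g i + g j)        ≡⟨ +-assoc (sum f) _ _ ⟨
  sum f + g i + g j          ≡⟨ cong (λ x → sum f + x + g j) (updateAt-updates i {λ _ → g i} f) ⟨
  sum f + h i + g j          ≡⟨ cong (_+ g j) (∑-update i (λ k k≢i → sym (updateAt-minimal k i {λ _ → g i} f k≢i))) ⟩
  sum h + f i + g j          ≡⟨ xy∙z≈xz∙y (sum h) (f i) (g j) ⟩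
  sum h + g j + f i          ≡⟨ cong (_+ f i) (∑-update j h≡g) ⟩
  sum g + h j + f i          ≡⟨ cong (λ x → sum g + x + f i) (updateAt-minimal j i {λ _ → g i} f (i≢j ∘ sym)) ⟩
  sum g + f j + f i          ≡⟨ xy∙z≈xz∙y (sum g) (f j) (f i) ⟩
  sum g + f i + f j          ≡⟨ +-assoc (sum g) _ _ ⟩
  sum g + (f i + f j)        ≤⟨ +-monoʳ-≤ (sum g) fij≤gij ⟩
  sum g + (g i + g j)        ∎)
  where
  open ≤-Reasoning
  h = updateAt f i (λ _ → g i)
  h≡g : ∀ k → k ≢ j → h k ≡ g k
  h≡g k k≢j with k ≟ i
  ... | yes refl = updateAt-updates i {λ _ → g i} f
  ... | no k≢i   = trans (updateAt-minimal k i {λ _ → g i} f k≢i) (f≡g k k≢i k≢j)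

∑-↑ : ∀ m {k} (f : Fin (m + k) → ℕ) → sum f ≡ ∑[ i < m ] f (i ↑ˡ k) + ∑[ j < k ] f (m ↑ʳ j)
∑-↑ zero    f = refl
∑-↑ (suc m) f = trans (cong (f zero +_) (∑-↑ m (f ∘ suc))) (sym (+-assoc (f zero) _ _))

∑-combine : ∀ m {k} (f : Fin (m * k) → ℕ) → sum f ≡ ∑[ i < m ] ∑[ j < k ] f (combine i j)
∑-combine zero    f = refl
∑-combine (suc m) {k} f = trans (∑-↑ k f) (cong (∑[ j < k ] f (j ↑ˡ m * k) +_) (∑-combine m (f ∘ (k ↑ʳ_))))

∑-remQuot : ∀ m {k} (g : Fin m → Fin k → ℕ) → ∑[ x < m * k ] g (quotient k x) (remainder {m} k x) ≡ ∑[ i < m ] ∑[ j < k ] g i j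
∑-remQuot m g = trans (∑-combine m _) (sum-cong-≗ λ i → sum-cong-≗ λ j → cong (uncurry g) (remQuot-combine i j))

period-induction : ∀ p .{{_ : NonZero p}} (P : ℕ → Set) →
                   (∀ r → r < p → P r) → (∀ t → P t → P (p + t)) → ∀ t → P t
period-induction p P base next t = subst P (sym (m≡m%n+[m/n]*n t p)) (shifted (t / p))
  where
  shifted : ∀ q → P (t % p + q * p)
  shifted zero    = subst P (sym (+-identityʳ (t % p))) (base (t % p) (m%n<n t p))
  shifted (suc q) = subst P (sym (x∙yz≈y∙xz (t % p) p (q * p))) (next _ (shifted q))

⌈/3⌉-shift : ∀ k a → ⌈ k * 3 + a /3⌉ ≡ k + ⌈ a /3⌉
⌈/3⌉-shift k a = begin
  (k * 3 + a + 2) / 3         ≡⟨ cong (_/ 3) (+-assoc (k * 3) a 2) ⟩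
  (k * 3 + (a + 2)) / 3       ≡⟨ +-distrib-/-∣ˡ (a + 2) (divides-refl k) ⟩
  k * 3 / 3 + (a + 2) / 3     ≡⟨ cong (_+ (a + 2) / 3) (m*n/n≡m k 3) ⟩
  k + ⌈ a /3⌉                 ∎
  where open ≡-Reasoning

⌈/4⌉-shift : ∀ k a → ⌈ k * 4 + a /4⌉ ≡ k + ⌈ a /4⌉
⌈/4⌉-shift k a = begin
  (k * 4 + a + 3) / 4         ≡⟨ cong (_/ 4) (+-assoc (k * 4) a 3) ⟩
  (k * 4 + (a + 3)) / 4       ≡⟨ +-distrib-/-∣ˡ (a + 3) (divides-refl k) ⟩
  k * 4 / 4 + (a + 3) / 4     ≡⟨ cong (_+ (a + 3) / 4) (m*n/n≡m k 4) ⟩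
  k + ⌈ a /4⌉                 ∎
  where open ≡-Reasoning

_⊕_ : ∀ {m} → (Fin m → ℕ) → (Fin m → ℕ) → Fin m → ℕ
(D ⊕ E) w = D w + E w

module _ (G : Graph) where

  move-source : ∀ u v D → move G u v D u ≡ D u ∸ 2
  move-source u v D with u ≟ u
  ... | yes _   = refl
  ... | no u≢u  = contradiction refl u≢u

  move-target : ∀ {u v} D → v ≢ u → move G u v D v ≡ suc (D v)
  move-target {u} {v} D v≢u with v ≟ u
  ... | yes v≡u = contradiction v≡u v≢u
  ... | no _ with v ≟ v
  ...   | yes _  = refl
  ...   | no v≢v = contradiction refl v≢v

  move-other : ∀ {u v w} D → w ≢ u → w ≢ v → move G u v D w ≡ D w
  move-other {u} {v} {w} D w≢u w≢v with w ≟ u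
  ... | yes w≡u = contradiction w≡u w≢u
  ... | no _ with w ≟ v
  ...   | yes w≡v = contradiction w≡v w≢v
  ...   | no _    = refl

  move-⊕ : ∀ {u v D E F} → 2 ≤ D u → F ≗ D ⊕ E → move G u v F ≗ move G u v D ⊕ E
  move-⊕ {u} {v} {D} {E} 2≤Du F≗D⊕E w with w ≟ u
  ... | yes refl = trans (cong (_∸ 2) (F≗D⊕E w)) (+-∸-comm (E w) 2≤Du)
  ... | no _ with w ≟ v
  ...   | yes _ = cong suc (F≗D⊕E w)
  ...   | no _  = F≗D⊕E w

  reach-⊕ : ∀ {D D'} → Reach G D D' → ∀ {E F} → F ≗ D ⊕ E → ∃ λ F' → Reach G F F' × F' ≗ D' ⊕ E
  reach-⊕ ε F≗D⊕E = _ , ε , F≗D⊕E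
  reach-⊕ (step u v adj 2≤Du ◅ rest) F≗D⊕E with reach-⊕ rest (move-⊕ 2≤Du F≗D⊕E)
  ... | F' , F→F' , F'≗ = F' , step u v adj (≤-trans (≤-trans 2≤Du (m≤m+n _ _)) (≤-reflexive (sym (F≗D⊕E u)))) ◅ F→F' , F'≗

  solvable-⊕ : ∀ {s t D E} → Solvable G s D → Solvable G t E → Solvable G (s + t) (D ⊕ E)
  solvable-⊕ {s} {t} {D} {E} solveD solveE v with solveD v | solveE v
  ... | D' , D→D' , s≤D'v | E' , E→E' , t≤E'v with reach-⊕ D→D' {E} (λ _ → refl)
  ... | F , D⊕E→F , F≗D'⊕E with reach-⊕ E→E' {D'} (λ w → trans (F≗D'⊕E w) (+-comm (D' w) (E w)))
  ... | F' , F→F' , F'≗E'⊕D' =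
    F' , D⊕E→F ◅◅ F→F' , ≤-trans (+-mono-≤ s≤D'v t≤E'v) (≤-reflexive (trans (+-comm (D' v) (E' v)) (sym (F'≗E'⊕D' v))))

  Attains : ℕ → ℕ → Set
  Attains t k = ∃ λ D → Solvable G t D × size G D ≡ k

  attains-⊕ : ∀ {s t k l} → Attains s k → Attains t l → Attains (s + t) (k + l)
  attains-⊕ (D , solveD , refl) (E , solveE , refl) = D ⊕ E , solvable-⊕ solveD solveE , ∑-distrib-+ D E

  attains-0 : Attains 0 0
  attains-0 = (λ _ → 0) , (λ v → _ , ε , z≤n) , trans (∑-const (n G) 0) (*-zeroʳ (n G))

module _ (G : Graph) (adj? : Decidable (Adj G)) where

  play : List (Fin (n G) × Fin (n G)) → Distribution G → Maybe (Distribution G)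
  play []             D = just D
  play ((u , v) ∷ ms) D with adj? u v | 2 ≤? D u
  ... | yes _ | yes _ = play ms (move G u v D)
  ... | _     | _     = nothing

  play-reach : ∀ ms {D D'} → play ms D ≡ just D' → Reach G D D'
  play-reach []             refl = ε
  play-reach ((u , v) ∷ ms) {D} played with adj? u v | 2 ≤? D u
  ... | yes adj | yes 2≤Du = step u v adj 2≤Du ◅ play-reach ms played
  ... | yes _   | no _     = case played of λ ()
  ... | no _    | _        = case played of λ ()

  reaches : ℕ → Distribution G → Fin (n G) → List (Fin (n G) × Fin (n G)) → Bool
  reaches t D v ms = maybe (λ D' → t ≤ᵇ D' v) false (play ms D)

  reaches-sound : ∀ {t D v} ms → T (reaches t D v ms) → ∃ λ D' → Reach G D D' × t ≤ D' v
  reaches-sound {t} {D} {v} ms ok with play ms D in played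
  ... | just D' = D' , play-reach ms played , ≤ᵇ⇒≤ t (D' v) ok

  solvable-by : ∀ {t D} (ms : Fin (n G) → List (Fin (n G) × Fin (n G))) →
                {True (all? λ v → T? (reaches t D v (ms v)))} → Solvable G t D
  solvable-by ms {ok} v = reaches-sound (ms v) (toWitness ok v)

  attains-by : ∀ {t} D (ms : Fin (n G) → List (Fin (n G) × Fin (n G))) →
               {True (all? λ v → T? (reaches t D v (ms v)))} → Attains G t (size G D)
  attains-by D ms {valid} = D , solvable-by ms {valid} , refl

-- Weight functions

-- x pebbles at distance d from the target are worth weight d x quarter-pebbles there.
weight : ℕ → ℕ → ℕ
weight 0             x = 4 * x
weight 1             x = 2 * x
weight (suc (suc _)) x = 2 * ⌊ x /2⌋

weight-2-≤ : ∀ x → weight 2 x ≤ x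
weight-2-≤ x = begin
  ⌊ x /2⌋ + (⌊ x /2⌋ + 0) ≡⟨ cong (⌊ x /2⌋ +_) (+-identityʳ ⌊ x /2⌋) ⟩
  ⌊ x /2⌋ + ⌊ x /2⌋       ≤⟨ +-monoʳ-≤ ⌊ x /2⌋ (⌊n/2⌋≤⌈n/2⌉ x) ⟩
  ⌊ x /2⌋ + ⌈ x /2⌉       ≡⟨ ⌊n/2⌋+⌈n/2⌉≡n x ⟩
  x                       ∎
  where open ≤-Reasoning

weight-mono : ∀ d {x y} → x ≤ y → weight d x ≤ weight d y
weight-mono 0             x≤y = *-monoʳ-≤ 4 x≤y
weight-mono 1             x≤y = *-monoʳ-≤ 2 x≤y
weight-mono (suc (suc _)) x≤y = *-monoʳ-≤ 2 (⌊n/2⌋-mono x≤y)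

weight-antitone : ∀ {d d'} x → d ≤ d' → weight d' x ≤ weight d x
weight-antitone {0}           {0}           x _ = ≤-refl
weight-antitone {0}           {1}           x _ = *-monoˡ-≤ x (m≤m+n 2 2)
weight-antitone {0}           {suc (suc _)} x _ = *-mono-≤ (m≤m+n 2 2) (⌊n/2⌋≤n x)
weight-antitone {1}           {1}           x _ = ≤-refl
weight-antitone {1}           {suc (suc _)} x _ = *-monoʳ-≤ 2 (⌊n/2⌋≤n x)
weight-antitone {suc (suc _)} {suc (suc _)} x _ = ≤-refl
weight-antitone {suc (suc _)} {1}           x (s≤s ())

weight-2+ : ∀ d x → weight d (2 + x) ≡ weight d 2 + weight d x
weight-2+ 0             x = *-distribˡ-+ 4 2 x
weight-2+ 1             x = *-distribˡ-+ 2 2 x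
weight-2+ (suc (suc _)) x = *-suc 2 ⌊ x /2⌋

weight-suc : ∀ d x → weight d (suc x) ≤ weight (suc d) 2 + weight d x
weight-suc 0             x = ≤-reflexive (*-suc 4 x)
weight-suc 1             x = ≤-reflexive (*-suc 2 x)
weight-suc (suc (suc _)) x = ≤-trans (*-monoʳ-≤ 2 (⌊n/2⌋-mono (n≤1+n (suc x)))) (≤-reflexive (*-suc 2 ⌊ x /2⌋))

weight-move : ∀ {s r} x y → s ≤ suc r → weight s x + weight r (suc y) ≤ weight s (2 + x) + weight r y
weight-move {s} {r} x y s≤1+r = begin
  weight s x + weight r (suc y)                ≤⟨ +-monoʳ-≤ (weight s x) (weight-suc r y) ⟩
  weight s x + (weight (suc r) 2 + weight r y) ≤⟨ +-monoʳ-≤ (weight s x) (+-monoˡ-≤ (weight r y) (weight-antitone 2 s≤1+r)) ⟩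
  weight s x + (weight s 2 + weight r y)       ≡⟨ x∙yz≈yx∙z (weight s x) (weight s 2) (weight r y) ⟩
  weight s 2 + weight s x + weight r y         ≡⟨ cong (_+ weight r y) (weight-2+ s x) ⟨
  weight s (2 + x) + weight r y                ∎
  where open ≤-Reasoning

weight-double : ∀ d h → weight d (2 * h) ≡ weight d 2 * h
weight-double 0             h = sym (*-assoc 4 2 h)
weight-double 1             h = sym (*-assoc 2 2 h)
weight-double (suc (suc _)) h = cong (2 *_) (trans (cong ⌊_/2⌋ (cong (h +_) (+-identityʳ h))) (sym (n≡⌊n+n/2⌋ h)))

Loopless : Graph → Set
Loopless G = ∀ u → ¬ Adj G u u

Lipschitz : (G : Graph) → (Fin (n G) → Fin (n G) → ℕ) → Set
Lipschitz G ℓ = ∀ v {u u'} → Adj G u u' → ℓ v u ≤ suc (ℓ v u')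

-- ℓ v w stands for the distance from the target v to w; only Lipschitz is used.
module Value (G : Graph) (loopless : Loopless G)
             (ℓ : Fin (n G) → Fin (n G) → ℕ) (lipschitz : Lipschitz G ℓ) where

  value : Fin (n G) → Distribution G → ℕ
  value v D = ∑[ w < n G ] weight (ℓ v w) (D w)

  value-step : ∀ v {D D'} → Step G D D' → value v D' ≤ value v D
  value-step v {D} (step u u' adj 2≤Du) = ∑-two-point-≤ u≢u'
    (λ w w≢u w≢u' → cong (weight (ℓ v w)) (move-other G D w≢u w≢u'))
    (begin
      weight (ℓ v u) (move G u u' D u) + weight (ℓ v u') (move G u u' D u')
        ≡⟨ cong₂ (λ x y → weight (ℓ v u) x + weight (ℓ v u') y) (move-source G u u' D) (move-target G D (u≢u' ∘ sym)) ⟩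
      weight (ℓ v u) (D u ∸ 2) + weight (ℓ v u') (suc (D u'))
        ≤⟨ weight-move (D u ∸ 2) (D u') (lipschitz v adj) ⟩
      weight (ℓ v u) (2 + (D u ∸ 2)) + weight (ℓ v u') (D u')
        ≡⟨ cong (λ x → weight (ℓ v u) x + weight (ℓ v u') (D u')) (m+[n∸m]≡n 2≤Du) ⟩
      weight (ℓ v u) (D u) + weight (ℓ v u') (D u') ∎)
    where
    open ≤-Reasoning
    u≢u' : u ≢ u'
    u≢u' refl = loopless u adj

  value-reach : ∀ v {D D'} → Reach G D D' → value v D' ≤ value v D
  value-reach v ε          = ≤-refl
  value-reach v (s ◅ rest) = ≤-trans (value-reach v rest) (value-step v s)

  value-solvable : ∀ {t D} → Solvable G t D → ∀ v → weight (ℓ v v) t ≤ value v D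
  value-solvable {t} {D} solvable v with solvable v
  ... | D' , D→D' , t≤D'v = begin
    weight (ℓ v v) t      ≤⟨ weight-mono (ℓ v v) t≤D'v ⟩
    weight (ℓ v v) (D' v) ≤⟨ ∑-term-≤ (λ w → weight (ℓ v w) (D' w)) v ⟩
    value v D'            ≤⟨ value-reach v D→D' ⟩
    value v D             ∎
    where open ≤-Reasoning

  value-even : ∀ v {D} → (∀ w → weight 2 (D w) ≡ D w) →
               value v D ≡ ∑[ w < n G ] (weight (ℓ v w) 2 * ⌊ D w /2⌋)
  value-even v {D} even = sum-cong-≗ λ w →
    trans (cong (weight (ℓ v w)) (sym (even w))) (weight-double (ℓ v w) ⌊ D w /2⌋)

  module Averaging (a b : ℕ)
                   (column : ∀ w x → ∑[ v < n G ] weight (ℓ v w) x ≡ a * x + b * weight 2 x) where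

    ∑-value : ∀ D → ∑[ v < n G ] value v D ≡ a * size G D + b * ∑[ w < n G ] weight 2 (D w)
    ∑-value D = begin
      ∑[ v < n G ] ∑[ w < n G ] weight (ℓ v w) (D w)               ≡⟨ ∑-comm (λ v w → weight (ℓ v w) (D w)) ⟩
      ∑[ w < n G ] ∑[ v < n G ] weight (ℓ v w) (D w)               ≡⟨ sum-cong-≗ (λ w → column w (D w)) ⟩
      ∑[ w < n G ] (a * D w + b * weight 2 (D w))                  ≡⟨ ∑-distrib-+ (λ w → a * D w) (λ w → b * weight 2 (D w)) ⟩
      ∑[ w < n G ] (a * D w) + ∑[ w < n G ] (b * weight 2 (D w))    ≡⟨ cong₂ _+_ (*-distribˡ-sum a D) (*-distribˡ-sum b (weight 2 ∘ D)) ⟨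
      a * size G D + b * ∑[ w < n G ] weight 2 (D w)                ∎
      where open ≡-Reasoning

    private
      nc≤∑value : ∀ {c D} → (∀ v → c ≤ value v D) → n G * c ≤ ∑[ v < n G ] value v D
      nc≤∑value {c} {D} c≤value = ≤-trans (≤-reflexive (sym (∑-const (n G) c))) (∑-mono-≤ c≤value)

      ∑value≤size : ∀ D → ∑[ v < n G ] value v D ≤ (a + b) * size G D
      ∑value≤size D = begin
        ∑[ v < n G ] value v D                           ≡⟨ ∑-value D ⟩
        a * size G D + b * ∑[ w < n G ] weight 2 (D w)   ≤⟨ +-monoʳ-≤ (a * size G D) (*-monoʳ-≤ b (∑-mono-≤ (weight-2-≤ ∘ D))) ⟩
        a * size G D + b * size G D                      ≡⟨ *-distribʳ-+ (size G D) a b ⟨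
        (a + b) * size G D                               ∎
        where open ≤-Reasoning

    value-average : ∀ {c D} → (∀ v → c ≤ value v D) → n G * c ≤ (a + b) * size G D
    value-average {D = D} c≤value = ≤-trans (nc≤∑value c≤value) (∑value≤size D)

    value-average-tight : ∀ {c D} .{{_ : NonZero b}} → (∀ v → c ≤ value v D) → (a + b) * size G D ≤ n G * c →
                          (∀ w → weight 2 (D w) ≡ D w) × (∀ v → c ≡ value v D)
    value-average-tight {c} {D} c≤value tight = ∑-tight (weight-2-≤ ∘ D) size≤even , ∑-tight c≤value value≤c
      where
      size≤even : size G D ≤ ∑[ w < n G ] weight 2 (D w)
      size≤even = *-cancelˡ-≤ b (+-cancelˡ-≤ (a * size G D) _ _ (begin
        a * size G D + b * size G D                      ≡⟨ *-distribʳ-+ (size G D) a b ⟨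
        (a + b) * size G D                               ≤⟨ tight ⟩
        n G * c                                          ≤⟨ nc≤∑value c≤value ⟩
        ∑[ v < n G ] value v D                           ≡⟨ ∑-value D ⟩
        a * size G D + b * ∑[ w < n G ] weight 2 (D w)   ∎))
        where open ≤-Reasoning
      value≤c : ∑[ v < n G ] value v D ≤ ∑[ v < n G ] c
      value≤c = ≤-trans (∑value≤size D) (≤-trans tight (≤-reflexive (sym (∑-const (n G) c))))

discrete : ∀ {m} → Fin m → Fin m → ℕ
discrete u v with u ≟ v
... | yes _ = 0
... | no _  = 1

discrete-refl : ∀ {m} (v : Fin m) → discrete v v ≡ 0
discrete-refl v with v ≟ v
... | yes _  = refl
... | no v≢v = contradiction refl v≢v

discrete-≢ : ∀ {m} {u v : Fin m} → u ≢ v → discrete u v ≡ 1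
discrete-≢ {u = u} {v} u≢v with u ≟ v
... | yes u≡v = contradiction u≡v u≢v
... | no _    = refl

discrete-≤1 : ∀ {m} (u v : Fin m) → discrete u v ≤ 1
discrete-≤1 u v with u ≟ v
... | yes _ = z≤n
... | no _  = ≤-refl

∑-discrete : ∀ {m} (f : ℕ → ℕ) (w : Fin (suc m)) → ∑[ v < suc m ] f (discrete v w) ≡ f 0 + m * f 1
∑-discrete {m} f w = begin
  ∑[ v < suc m ] f (discrete v w)                       ≡⟨ sum-remove (λ v → f (discrete v w)) ⟩
  f (discrete w w) + ∑[ i < m ] f (discrete (punchIn w i) w) ≡⟨ cong₂ _+_ (cong f (discrete-refl w)) (sum-cong-≗ λ i → cong f (discrete-≢ (punchInᵢ≢i w i))) ⟩
  f 0 + ∑[ i < m ] f 1                                  ≡⟨ cong (f 0 +_) (∑-const m (f 1)) ⟩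
  f 0 + m * f 1                                         ∎
  where open ≡-Reasoning

K-adj? : ∀ m → Decidable (Adj (K m))
K-adj? m u v = ¬? (u ≟ v)

K-loopless : ∀ m → Loopless (K m)
K-loopless m u u≢u = u≢u refl

K-lipschitz : ∀ m → Lipschitz (K m) discrete
K-lipschitz m v {u} _ = ≤-trans (discrete-≤1 v u) (s≤s z≤n)

lipschitz-suc : ∀ {G ℓ} → Lipschitz G ℓ → Lipschitz G (λ v w → suc (ℓ v w))
lipschitz-suc lipschitz v adj = s≤s (lipschitz v adj)

module _ (G H : Graph) where

  private
    π₁ : Fin (n (G □ H)) → Fin (n G)
    π₁ = quotient {n G} (n H)
    π₂ : Fin (n (G □ H)) → Fin (n H)
    π₂ = remainder {n G} (n H)

  □-adj? : Decidable (Adj G) → Decidable (Adj H) → Decidable (Adj (G □ H))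
  □-adj? G? H? x y = (G? (π₁ x) (π₁ y) ×-dec π₂ x ≟ π₂ y) ⊎-dec (π₁ x ≟ π₁ y ×-dec H? (π₂ x) (π₂ y))

  □-loopless : Loopless G → Loopless H → Loopless (G □ H)
  □-loopless G-loopless _ u (inj₁ (adj , _)) = G-loopless (π₁ u) adj
  □-loopless _ H-loopless u (inj₂ (_ , adj)) = H-loopless (π₂ u) adj

  □-level : (Fin (n G) → Fin (n G) → ℕ) → (Fin (n H) → Fin (n H) → ℕ) → Fin (n (G □ H)) → Fin (n (G □ H)) → ℕ
  □-level ℓ₁ ℓ₂ v w = ℓ₁ (π₁ v) (π₁ w) + ℓ₂ (π₂ v) (π₂ w)

  □-lipschitz : ∀ {ℓ₁ ℓ₂} → Lipschitz G ℓ₁ → Lipschitz H ℓ₂ → Lipschitz (G □ H) (□-level ℓ₁ ℓ₂)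
  □-lipschitz {ℓ₁} {ℓ₂} lip₁ _ v (inj₁ (adj , b≡b')) =
    +-mono-≤ (lip₁ (π₁ v) adj) (≤-reflexive (cong (ℓ₂ (π₂ v)) b≡b'))
  □-lipschitz {ℓ₁} {ℓ₂} _ lip₂ v (inj₂ (a≡a' , adj)) =
    ≤-trans (+-mono-≤ (≤-reflexive (cong (ℓ₁ (π₁ v)) a≡a')) (lip₂ (π₂ v) adj)) (≤-reflexive (+-suc _ _))

hamming : ∀ m k → Fin (m * k) → Fin (m * k) → ℕ
hamming m k = □-level (K m) (K k) discrete discrete

∑-hamming : ∀ m k (f : ℕ → ℕ) (w : Fin (suc m * suc k)) →
            ∑[ v < suc m * suc k ] f (hamming (suc m) (suc k) v w) ≡ (f 0 + k * f 1) + m * (f 1 + k * f 2)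
∑-hamming m k f w = begin
  ∑[ v < suc m * suc k ] f (hamming (suc m) (suc k) v w)        ≡⟨ ∑-remQuot (suc m) (λ i j → f (discrete i a + discrete j b)) ⟩
  ∑[ i < suc m ] ∑[ j < suc k ] f (discrete i a + discrete j b) ≡⟨ sum-cong-≗ (λ i → ∑-discrete (λ e → f (discrete i a + e)) b) ⟩
  ∑[ i < suc m ] (f (discrete i a + 0) + k * f (discrete i a + 1)) ≡⟨ ∑-discrete (λ d → f (d + 0) + k * f (d + 1)) a ⟩
  (f 0 + k * f 1) + m * (f 1 + k * f 2)                          ∎
  where
  open ≡-Reasoning
  a = quotient {suc m} (suc k) w
  b = remainder {suc m} (suc k) w

-- Raising every level by one turns the weights 4x, 2x into 2x, 2⌊x/2⌋, which see parity.
module CompleteValue (m : ℕ) where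
  open Value (K (suc m)) (K-loopless (suc m)) (λ v w → suc (discrete v w)) (lipschitz-suc (K-lipschitz (suc m))) public
  open Averaging 2 m (λ w x → ∑-discrete (λ d → weight (suc d) x) w) public

  value-solvable-K : ∀ t {D} → Solvable (K (suc m)) (2 * t) D → ∀ v → 4 * t ≤ value v D
  value-solvable-K t {D} solvable v = subst (_≤ value v D) weight-at-target (value-solvable solvable v)
    where
    weight-at-target : weight (suc (discrete v v)) (2 * t) ≡ 4 * t
    weight-at-target = trans (cong (λ d → weight (suc d) (2 * t)) (discrete-refl v)) (sym (*-assoc 2 2 t))

K-lower-bound : ∀ m t {D} → Solvable (K (suc m)) (2 * t) D → suc m * (4 * t) ≤ (2 + m) * size (K (suc m)) D
K-lower-bound m t {D} solvable = value-average {D = D} (value-solvable-K t solvable)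
  where open CompleteValue m

K₂-optimal : ∀ t → IsOptPebbling (K 2) (2 * t) ⌈ 8 * t /3⌉
K₂-optimal t = upper t , lower
  where
  upper : ∀ t → Attains (K 2) (2 * t) ⌈ 8 * t /3⌉
  upper = period-induction 3 _ base add-unit
    where
    base : ∀ r → r < 3 → Attains (K 2) (2 * r) ⌈ 8 * r /3⌉
    base 0 _ = attains-0 (K 2)
    base 1 _ = attains-by (K 2) (K-adj? 2) (lookup (2 ∷ 1 ∷ [])) λ { 0F → [] ; 1F → (0F , 1F) ∷ [] }
    base 2 _ = attains-by (K 2) (K-adj? 2) (lookup (3 ∷ 3 ∷ [])) λ { 0F → (1F , 0F) ∷ [] ; 1F → (0F , 1F) ∷ [] }
    base (suc (suc (suc _))) (s≤s (s≤s (s≤s ())))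
    add-unit : ∀ t → Attains (K 2) (2 * t) ⌈ 8 * t /3⌉ → Attains (K 2) (2 * (3 + t)) ⌈ 8 * (3 + t) /3⌉
    add-unit t attains = subst₂ (Attains (K 2)) (sym (*-distribˡ-+ 2 3 t))
      (sym (trans (cong ⌈_/3⌉ (*-distribˡ-+ 8 3 t)) (⌈/3⌉-shift 8 (8 * t))))
      (attains-⊕ (K 2) unit attains)
      where
      unit : Attains (K 2) 6 8
      unit = attains-by (K 2) (K-adj? 2) (lookup (4 ∷ 4 ∷ [])) λ
        { 0F → (1F , 0F) ∷ (1F , 0F) ∷ [] ; 1F → (0F , 1F) ∷ (0F , 1F) ∷ [] }
  lower : ∀ D → Solvable (K 2) (2 * t) D → ⌈ 8 * t /3⌉ ≤ size (K 2) D
  lower D solvable = begin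
    ⌈ 8 * t /3⌉                 ≤⟨ /-monoˡ-≤ 3 (+-monoˡ-≤ 2 (≤-trans (≤-reflexive (*-assoc 2 4 t)) (K-lower-bound 1 t solvable))) ⟩
    ⌈ 3 * size (K 2) D /3⌉      ≡⟨ cong ⌈_/3⌉ (trans (*-comm 3 (size (K 2) D)) (sym (+-identityʳ _))) ⟩
    ⌈ size (K 2) D * 3 + 0 /3⌉  ≡⟨ ⌈/3⌉-shift (size (K 2) D) 0 ⟩
    size (K 2) D + 0            ≡⟨ +-identityʳ _ ⟩
    size (K 2) D                ∎
    where open ≤-Reasoning

K₃-lower-bound : ∀ t {D} → Solvable (K 3) (2 * t) D → 3 * t ≤ size (K 3) D
K₃-lower-bound t solvable =
  *-cancelˡ-≤ 4 (≤-trans (≤-reflexive (trans (sym (*-assoc 4 3 t)) (*-assoc 3 4 t))) (K-lower-bound 2 t solvable))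

K₃-rows-balanced : ∀ {t} (h : Fin 3 → ℕ) →
                   (∀ v → ∑[ w < 3 ] (weight (suc (discrete v w)) 2 * h w) ≡ 4 * t) → 2 ∣ t
K₃-rows-balanced {t} h rows = divides (h 0F) (sym (*-cancelˡ-≡ (h 0F * 2) t 4 (begin
  4 * (h 0F * 2)  ≡⟨ cong (4 *_) (*-comm (h 0F) 2) ⟩
  4 * (2 * h 0F)  ≡⟨ *-assoc 4 2 (h 0F) ⟨
  8 * h 0F        ≡⟨ +-cancelʳ-≡ (8 * t) (8 * h 0F) (4 * t) eight-rows ⟩
  4 * t           ∎)))
  where
  open ≡-Reasoning
  R : Fin 3 → ℕ
  R v = ∑[ w < 3 ] (weight (suc (discrete v w)) 2 * h w)
  -- 8·h₀ = 3R₀ − R₁ − R₂, with each R v written as it normalises.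
  combination : ∀ x y z → 8 * x + ((2 * x + (4 * y + (2 * z + 0))) + (2 * x + (2 * y + (4 * z + 0))))
                          ≡ 3 * (4 * x + (2 * y + (2 * z + 0)))
  combination = solve-∀
  eight-rows : 8 * h 0F + 8 * t ≡ 4 * t + 8 * t
  eight-rows = begin
    8 * h 0F + 8 * t            ≡⟨ cong (8 * h 0F +_) (*-distribʳ-+ t 4 4) ⟩
    8 * h 0F + (4 * t + 4 * t)  ≡⟨ cong (8 * h 0F +_) (cong₂ _+_ (rows 1F) (rows 2F)) ⟨
    8 * h 0F + (R 1F + R 2F)    ≡⟨ combination (h 0F) (h 1F) (h 2F) ⟩
    3 * R 0F                    ≡⟨ cong (3 *_) (rows 0F) ⟩
    3 * (4 * t)                 ≡⟨ *-assoc 3 4 t ⟨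
    12 * t                      ≡⟨ *-distribʳ-+ t 4 8 ⟩
    4 * t + 8 * t               ∎

K₃-tight : ∀ t {D} → Solvable (K 3) (2 * t) D → size (K 3) D ≡ 3 * t → 2 ∣ t
K₃-tight t {D} solvable size≡3t = K₃-rows-balanced (λ w → ⌊ D w /2⌋) rows
  where
  open CompleteValue 2
  at-bound : 4 * size (K 3) D ≤ 3 * (4 * t)
  at-bound = ≤-reflexive (trans (cong (4 *_) size≡3t) (trans (sym (*-assoc 4 3 t)) (*-assoc 3 4 t)))
  tight = value-average-tight {4 * t} {D} (value-solvable-K t solvable) at-bound
  rows : ∀ v → ∑[ w < 3 ] (weight (suc (discrete v w)) 2 * ⌊ D w /2⌋) ≡ 4 * t
  rows v = trans (sym (value-even v (proj₁ tight))) (sym (proj₂ tight v))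

K₃-optimal : ∀ t → IsOptPebbling (K 3) (2 * t) (3 * t + t % 2)
K₃-optimal t = upper t , lower
  where
  upper : ∀ t → Attains (K 3) (2 * t) (3 * t + t % 2)
  upper = period-induction 2 _ base add-unit
    where
    base : ∀ r → r < 2 → Attains (K 3) (2 * r) (3 * r + r % 2)
    base 0 _ = attains-0 (K 3)
    base 1 _ = attains-by (K 3) (K-adj? 3) (lookup (2 ∷ 2 ∷ 0 ∷ [])) λ
      { 0F → [] ; 1F → [] ; 2F → (0F , 2F) ∷ (1F , 2F) ∷ [] }
    base (suc (suc _)) (s≤s (s≤s ()))
    add-unit : ∀ t → Attains (K 3) (2 * t) (3 * t + t % 2) → Attains (K 3) (2 * (2 + t)) (3 * (2 + t) + (2 + t) % 2)
    add-unit t attains = subst₂ (Attains (K 3)) (sym (*-distribˡ-+ 2 2 t))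
      (sym (trans (cong (_+ t % 2) (*-distribˡ-+ 3 2 t)) (+-assoc 6 (3 * t) (t % 2))))
      (attains-⊕ (K 3) unit attains)
      where
      unit : Attains (K 3) 4 6
      unit = attains-by (K 3) (K-adj? 3) (lookup (2 ∷ 2 ∷ 2 ∷ [])) λ
        { 0F → (1F , 0F) ∷ (2F , 0F) ∷ []
        ; 1F → (0F , 1F) ∷ (2F , 1F) ∷ []
        ; 2F → (0F , 2F) ∷ (1F , 2F) ∷ [] }
  lower : ∀ D → Solvable (K 3) (2 * t) D → 3 * t + t % 2 ≤ size (K 3) D
  lower D solvable with t % 2 in parity
  ... | 0           = ≤-trans (≤-reflexive (+-identityʳ (3 * t))) (K₃-lower-bound t solvable)
  ... | 1           = ≤-trans (≤-reflexive (+-comm (3 * t) 1)) (≤∧≢⇒< (K₃-lower-bound t solvable) (λ tight →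
                        case trans (sym (n∣m⇒m%n≡0 t 2 (K₃-tight t solvable (sym tight)))) parity of λ ()))
  ... | suc (suc _) = contradiction (subst (_< 2) parity (m%n<n t 2)) λ { (s≤s (s≤s ())) }

-- The prism

-- Vertex 3a + b of the prism is the pair (a , b) of K 2 × K 3.
prism : Graph
prism = K 2 □ K 3

prism-adj? : Decidable (Adj prism)
prism-adj? = □-adj? (K 2) (K 3) (K-adj? 2) (K-adj? 3)

module PrismValue where
  open Value prism (□-loopless (K 2) (K 3) (K-loopless 2) (K-loopless 3))
             (hamming 2 3) (□-lipschitz (K 2) (K 3) (K-lipschitz 2) (K-lipschitz 3)) public

  column : ∀ w x → ∑[ v < 6 ] weight (hamming 2 3 v w) x ≡ 10 * x + 2 * weight 2 x
  column w x = trans (∑-hamming 1 2 (λ d → weight d x) w) (collect x (weight 2 x))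
    where
    collect : ∀ x e → 4 * x + 2 * (2 * x) + 1 * (2 * x + 2 * e) ≡ 10 * x + 2 * e
    collect = solve-∀

  open Averaging 10 2 column public

  value-solvable-prism : ∀ {t D} → Solvable prism t D → ∀ v → 4 * t ≤ value v D
  value-solvable-prism {t} {D} solvable v = subst (λ d → weight d t ≤ value v D) hamming-refl (value-solvable solvable v)
    where
    hamming-refl : hamming 2 3 v v ≡ 0
    hamming-refl = cong₂ _+_ (discrete-refl (quotient {2} 3 v)) (discrete-refl (remainder {2} 3 v))

prism-lower-bound : ∀ {t D} → Solvable prism t D → 2 * t ≤ size prism D
prism-lower-bound {t} {D} solvable = *-cancelˡ-≤ 12
  (≤-trans (≤-reflexive (trans (sym (*-assoc 12 2 t)) (*-assoc 6 4 t))) (value-average {D = D} (value-solvable-prism solvable)))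
  where open PrismValue

prism-rows-balanced : ∀ {t} (h : Fin 6 → ℕ) →
                      (∀ v → ∑[ w < 6 ] (weight (hamming 2 3 v w) 2 * h w) ≡ 4 * t) → 6 ∣ t
prism-rows-balanced {t} h rows = divides (h 0F) (sym (*-cancelˡ-≡ (h 0F * 6) t 4 (begin
  4 * (h 0F * 6)  ≡⟨ cong (4 *_) (*-comm (h 0F) 6) ⟩
  4 * (6 * h 0F)  ≡⟨ *-assoc 4 6 (h 0F) ⟨
  24 * h 0F       ≡⟨ +-cancelʳ-≡ (28 * t) (24 * h 0F) (4 * t) combined-rows ⟩
  4 * t           ∎)))
  where
  open ≡-Reasoning
  R : Fin 6 → ℕ
  R v = ∑[ w < 6 ] (weight (hamming 2 3 v w) 2 * h w)
  -- 24·h₀ = 6R₀ − 2R₁ − 2R₂ − 3R₃ + R₄ + R₅ (the first row of the inverse of the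
  -- weight matrix), with each R v written as it normalises.
  combination : ∀ a b c d e f →
    24 * a + (2 * (4 * a + (8 * b + (4 * c + (2 * d + (4 * e + (2 * f + 0))))))
           + (2 * (4 * a + (4 * b + (8 * c + (2 * d + (2 * e + (4 * f + 0))))))
           + 3 * (4 * a + (2 * b + (2 * c + (8 * d + (4 * e + (4 * f + 0))))))))
    ≡ 6 * (8 * a + (4 * b + (4 * c + (4 * d + (2 * e + (2 * f + 0))))))
      + ((2 * a + (4 * b + (2 * c + (4 * d + (8 * e + (4 * f + 0))))))
      + (2 * a + (2 * b + (4 * c + (4 * d + (4 * e + (8 * f + 0)))))))
  combination = solve-∀
  split-7 : ∀ x → 7 * x ≡ 2 * x + (2 * x + 3 * x)
  split-7 = solve-∀
  split-8 : ∀ x → 6 * x + (x + x) ≡ x + 7 * x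
  split-8 = solve-∀
  combined-rows : 24 * h 0F + 28 * t ≡ 4 * t + 28 * t
  combined-rows = begin
    24 * h 0F + 28 * t                                       ≡⟨ cong (24 * h 0F +_) (trans (*-assoc 7 4 t) (split-7 (4 * t))) ⟩
    24 * h 0F + (2 * (4 * t) + (2 * (4 * t) + 3 * (4 * t)))  ≡⟨ cong (λ x → 24 * h 0F + x) (cong₂ _+_ (cong (2 *_) (rows 1F))
                                                                  (cong₂ _+_ (cong (2 *_) (rows 2F)) (cong (3 *_) (rows 3F)))) ⟨
    24 * h 0F + (2 * R 1F + (2 * R 2F + 3 * R 3F))            ≡⟨ combination (h 0F) (h 1F) (h 2F) (h 3F) (h 4F) (h 5F) ⟩
    6 * R 0F + (R 4F + R 5F)                                  ≡⟨ cong₂ _+_ (cong (6 *_) (rows 0F)) (cong₂ _+_ (rows 4F) (rows 5F)) ⟩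
    6 * (4 * t) + (4 * t + 4 * t)                             ≡⟨ split-8 (4 * t) ⟩
    4 * t + 7 * (4 * t)                                       ≡⟨ cong (4 * t +_) (*-assoc 7 4 t) ⟨
    4 * t + 28 * t                                            ∎

prism-tight : ∀ {t D} → Solvable prism t D → size prism D ≡ 2 * t → 6 ∣ t
prism-tight {t} {D} solvable size≡2t = prism-rows-balanced (λ w → ⌊ D w /2⌋) rows
  where
  open PrismValue
  at-bound : 12 * size prism D ≤ 6 * (4 * t)
  at-bound = ≤-reflexive (trans (cong (12 *_) size≡2t) (trans (sym (*-assoc 12 2 t)) (*-assoc 6 4 t)))
  tight = value-average-tight {4 * t} {D} (value-solvable-prism solvable) at-bound
  rows : ∀ v → ∑[ w < 6 ] (weight (hamming 2 3 v w) 2 * ⌊ D w /2⌋) ≡ 4 * t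
  rows v = trans (sym (value-even v (proj₁ tight))) (sym (proj₂ tight v))

closedForm-+6 : ∀ t → closedForm (6 + t) ≡ 12 + closedForm t
closedForm-+6 t with t % 6
... | zero  = trans (cong (12 *_) (+-distrib-/-∣ˡ {6} t {6} (divides-refl 1))) (*-suc 12 (t / 6))
... | suc r = trans (cong (λ q → 12 * q + 2 * suc r + 1) (+-distrib-/-∣ˡ {6} t {6} (divides-refl 1))) (regroup (t / 6) (2 * suc r))
  where
  regroup : ∀ q x → 12 * (1 + q) + x + 1 ≡ 12 + (12 * q + x + 1)
  regroup = solve-∀

closedForm-≤ : ∀ {t S} → 2 * t ≤ S → (S ≡ 2 * t → 6 ∣ t) → closedForm t ≤ S
closedForm-≤ {t} {S} 2t≤S tight with t % 6 in t%6≡ | m≡m%n+[m/n]*n t 6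
... | zero  | t≡ = ≤-trans (≤-reflexive (trans (as-2t (t / 6)) (cong (2 *_) (sym t≡)))) 2t≤S
  where
  as-2t : ∀ q → 12 * q ≡ 2 * (0 + q * 6)
  as-2t = solve-∀
... | suc r | t≡ = ≤-trans (≤-reflexive (trans (as-2t (t / 6) r) (cong (λ t → suc (2 * t)) (sym t≡))))
                           (≤∧≢⇒< 2t≤S λ 2t≡S → case trans (sym (n∣m⇒m%n≡0 t 6 (tight (sym 2t≡S)))) t%6≡ of λ ())
  where
  as-2t : ∀ q r → 12 * q + 2 * (1 + r) + 1 ≡ 1 + 2 * ((1 + r) + q * 6)
  as-2t = solve-∀

prism-optimal : ∀ t → IsOptPebbling prism t (closedForm t)
prism-optimal t = upper t , λ D solvable → closedForm-≤ (prism-lower-bound solvable) (prism-tight solvable)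
  where
  upper : ∀ t → Attains prism t (closedForm t)
  upper = period-induction 6 _ base add-unit
    where
    base : ∀ r → r < 6 → Attains prism r (closedForm r)
    base 0 _ = attains-0 prism
    base 1 _ = attains-by prism prism-adj? (lookup (0 ∷ 0 ∷ 1 ∷ 0 ∷ 0 ∷ 2 ∷ [])) λ
      { 0F → (5F , 2F) ∷ (2F , 0F) ∷ []
      ; 1F → (5F , 2F) ∷ (2F , 1F) ∷ []
      ; 2F → []
      ; 3F → (5F , 3F) ∷ []
      ; 4F → (5F , 4F) ∷ []
      ; 5F → [] }
    base 2 _ = attains-by prism prism-adj? (lookup (0 ∷ 0 ∷ 2 ∷ 1 ∷ 2 ∷ 0 ∷ [])) λ
      { 0F → (2F , 0F) ∷ (4F , 3F) ∷ (3F , 0F) ∷ []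
      ; 1F → (2F , 1F) ∷ (4F , 1F) ∷ []
      ; 2F → []
      ; 3F → (4F , 3F) ∷ []
      ; 4F → []
      ; 5F → (2F , 5F) ∷ (4F , 5F) ∷ [] }
    base 3 _ = attains-by prism prism-adj? (lookup (0 ∷ 0 ∷ 4 ∷ 1 ∷ 2 ∷ 0 ∷ [])) λ
      { 0F → (2F , 0F) ∷ (2F , 0F) ∷ (4F , 3F) ∷ (3F , 0F) ∷ []
      ; 1F → (2F , 1F) ∷ (2F , 1F) ∷ (4F , 1F) ∷ []
      ; 2F → []
      ; 3F → (2F , 0F) ∷ (2F , 0F) ∷ (0F , 3F) ∷ (4F , 3F) ∷ []
      ; 4F → (2F , 1F) ∷ (2F , 1F) ∷ (1F , 4F) ∷ []
      ; 5F → (2F , 5F) ∷ (2F , 5F) ∷ (4F , 5F) ∷ [] }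
    base 4 _ = attains-by prism prism-adj? (lookup (0 ∷ 1 ∷ 2 ∷ 4 ∷ 2 ∷ 0 ∷ [])) λ
      { 0F → (2F , 0F) ∷ (3F , 0F) ∷ (3F , 0F) ∷ (4F , 1F) ∷ (1F , 0F) ∷ []
      ; 1F → (2F , 1F) ∷ (3F , 0F) ∷ (3F , 0F) ∷ (0F , 1F) ∷ (4F , 1F) ∷ []
      ; 2F → (3F , 0F) ∷ (3F , 0F) ∷ (0F , 2F) ∷ (4F , 1F) ∷ (1F , 2F) ∷ []
      ; 3F → []
      ; 4F → (3F , 4F) ∷ (3F , 4F) ∷ []
      ; 5F → (2F , 5F) ∷ (3F , 5F) ∷ (3F , 5F) ∷ (4F , 5F) ∷ [] }
    base 5 _ = attains-by prism prism-adj? (lookup (0 ∷ 1 ∷ 4 ∷ 4 ∷ 2 ∷ 0 ∷ [])) λ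
      { 0F → (2F , 0F) ∷ (2F , 0F) ∷ (3F , 0F) ∷ (3F , 0F) ∷ (4F , 1F) ∷ (1F , 0F) ∷ []
      ; 1F → (2F , 1F) ∷ (2F , 1F) ∷ (3F , 0F) ∷ (3F , 0F) ∷ (0F , 1F) ∷ (4F , 1F) ∷ []
      ; 2F → (4F , 1F) ∷ (1F , 2F) ∷ []
      ; 3F → (4F , 3F) ∷ []
      ; 4F → (2F , 1F) ∷ (1F , 4F) ∷ (3F , 4F) ∷ (3F , 4F) ∷ []
      ; 5F → (2F , 5F) ∷ (2F , 5F) ∷ (3F , 5F) ∷ (3F , 5F) ∷ (4F , 5F) ∷ [] }
    base (suc (suc (suc (suc (suc (suc _)))))) (s≤s (s≤s (s≤s (s≤s (s≤s (s≤s ()))))))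
    add-unit : ∀ t → Attains prism t (closedForm t) → Attains prism (6 + t) (closedForm (6 + t))
    add-unit t attains = subst (Attains prism (6 + t)) (sym (closedForm-+6 t)) (attains-⊕ prism unit attains)
      where
      unit : Attains prism 6 12
      unit = attains-by prism prism-adj? (lookup (2 ∷ 2 ∷ 2 ∷ 2 ∷ 2 ∷ 2 ∷ [])) λ
        { 0F → (4F , 3F) ∷ (5F , 3F) ∷ (3F , 0F) ∷ (3F , 0F) ∷ (1F , 0F) ∷ (2F , 0F) ∷ []
        ; 1F → (3F , 4F) ∷ (5F , 4F) ∷ (4F , 1F) ∷ (4F , 1F) ∷ (0F , 1F) ∷ (2F , 1F) ∷ []
        ; 2F → (3F , 5F) ∷ (4F , 5F) ∷ (5F , 2F) ∷ (5F , 2F) ∷ (0F , 2F) ∷ (1F , 2F) ∷ []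
        ; 3F → (1F , 0F) ∷ (2F , 0F) ∷ (0F , 3F) ∷ (0F , 3F) ∷ (4F , 3F) ∷ (5F , 3F) ∷ []
        ; 4F → (0F , 1F) ∷ (2F , 1F) ∷ (1F , 4F) ∷ (1F , 4F) ∷ (3F , 4F) ∷ (5F , 4F) ∷ []
        ; 5F → (0F , 2F) ∷ (1F , 2F) ∷ (2F , 5F) ∷ (2F , 5F) ∷ (3F , 5F) ∷ (4F , 5F) ∷ [] }

max-formula : ∀ t → ⌈ 2 * (3 * t + t % 2) /3⌉ ⊔ ⌈ 3 * ⌈ 8 * t /3⌉ /4⌉ ≡ closedForm t
max-formula = period-induction 6 _ base add-period
  where
  base : ∀ r → r < 6 → ⌈ 2 * (3 * r + r % 2) /3⌉ ⊔ ⌈ 3 * ⌈ 8 * r /3⌉ /4⌉ ≡ closedForm r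
  base 0 _ = refl
  base 1 _ = refl
  base 2 _ = refl
  base 3 _ = refl
  base 4 _ = refl
  base 5 _ = refl
  base (suc (suc (suc (suc (suc (suc _)))))) (s≤s (s≤s (s≤s (s≤s (s≤s (s≤s ()))))))
  add-period : ∀ t → ⌈ 2 * (3 * t + t % 2) /3⌉ ⊔ ⌈ 3 * ⌈ 8 * t /3⌉ /4⌉ ≡ closedForm t →
               ⌈ 2 * (3 * (6 + t) + (6 + t) % 2) /3⌉ ⊔ ⌈ 3 * ⌈ 8 * (6 + t) /3⌉ /4⌉ ≡ closedForm (6 + t)
  -- (6 + t) % 2 computes to t % 2.
  add-period t eq = begin
    ⌈ 2 * (3 * (6 + t) + t % 2) /3⌉ ⊔ ⌈ 3 * ⌈ 8 * (6 + t) /3⌉ /4⌉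
      ≡⟨ cong₂ (λ x y → ⌈ x /3⌉ ⊔ ⌈ 3 * ⌈ y /3⌉ /4⌉) (regroup t (t % 2)) (*-distribˡ-+ 8 6 t) ⟩
    ⌈ 12 * 3 + 2 * (3 * t + t % 2) /3⌉ ⊔ ⌈ 3 * ⌈ 16 * 3 + 8 * t /3⌉ /4⌉
      ≡⟨ cong₂ _⊔_ (⌈/3⌉-shift 12 (2 * (3 * t + t % 2))) (cong (λ c → ⌈ 3 * c /4⌉) (⌈/3⌉-shift 16 (8 * t))) ⟩
    (12 + ⌈ 2 * (3 * t + t % 2) /3⌉) ⊔ ⌈ 3 * (16 + ⌈ 8 * t /3⌉) /4⌉
      ≡⟨ cong (λ x → (12 + ⌈ 2 * (3 * t + t % 2) /3⌉) ⊔ ⌈ x /4⌉) (*-distribˡ-+ 3 16 ⌈ 8 * t /3⌉) ⟩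
    (12 + ⌈ 2 * (3 * t + t % 2) /3⌉) ⊔ ⌈ 12 * 4 + 3 * ⌈ 8 * t /3⌉ /4⌉
      ≡⟨ cong ((12 + ⌈ 2 * (3 * t + t % 2) /3⌉) ⊔_) (⌈/4⌉-shift 12 (3 * ⌈ 8 * t /3⌉)) ⟩
    (12 + ⌈ 2 * (3 * t + t % 2) /3⌉) ⊔ (12 + ⌈ 3 * ⌈ 8 * t /3⌉ /4⌉)
      ≡⟨ +-distribˡ-⊔ 12 ⌈ 2 * (3 * t + t % 2) /3⌉ ⌈ 3 * ⌈ 8 * t /3⌉ /4⌉ ⟨
    12 + (⌈ 2 * (3 * t + t % 2) /3⌉ ⊔ ⌈ 3 * ⌈ 8 * t /3⌉ /4⌉)
      ≡⟨ cong (12 +_) eq ⟩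
    12 + closedForm t
      ≡⟨ closedForm-+6 t ⟨
    closedForm (6 + t) ∎
    where
    open ≡-Reasoning
    regroup : ∀ t p → 2 * (3 * (6 + t) + p) ≡ 12 * 3 + 2 * (3 * t + p)
    regroup = solve-∀

proposition3p13 : (t : ℕ) → 1 ≤ t →
    Σ ℕ (λ b → Σ ℕ (λ c →
    IsOptPebbling (K 3) (2 * t) b × IsOptPebbling (K 2) (2 * t) c
    × IsOptPebbling (K 2 □ K 3) t (⌈ 2 * b /3⌉ ⊔ ⌈ 3 * c /4⌉)
    × IsOptPebbling (K 2 □ K 3) t (closedForm t)))
proposition3p13 t _ = 3 * t + t % 2 , ⌈ 8 * t /3⌉ , K₃-optimal t , K₂-optimal t ,
  subst (IsOptPebbling prism t) (sym (max-formula t)) (prism-optimal t) , prism-optimal t
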